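{- Let $U$ be a finite set, $F$ a family of subsets of $U$, and $k$ an integer. Let $G(U,F)$ be the graph constructed from $U$ and $F$ as described in the context. If there is a subset $F' \subseteq F$ with $|F'| \le k$ and $U = \bigcup_{T \in F'} T$, then there exists a minimal $a,b$-separator $S$ of $G(U,F)$ with $S \subseteq V(G(U,F)) \setminus \{a\}$, $U \subseteq S$, and $|S| \le |U| + |F| + k$.
   Context: The graph $G(U,F)$ has vertex set consisting of two vertices $a,b$, a vertex for each element $z \in U$ (identified with $z$), and for each set $T \in F$ three vertices $v_T, u_T, w_T$. Its edges are: $a$ is adjacent to every $z \in U$ and to every $u_T, w_T$ ($T \in F$); $b$ is adjacent to every $v_T$ ($T \in F$); $u_T$ and $w_T$ are each adjacent to $v_T$ (and to $a$ only besides); and $z \in U$ is adjacent to $v_T$ whenever $z \in T$. Thus $N(a) = U \cup \{u_T, w_T : T \in F\}$ and $N(b) = \{v_T : T \in F\}$. A minimal $a,b$-separator is a vertex set $S$ such that $a$ and $b$ lie in different connected components of the graph obtained by deleting $S$, inclusion-wise minimal with this property. -}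

module Defs where

open import Data.Nat using (ℕ; _+_)
open import Data.Bool using (Bool; true; false)
open import Data.Fin using (Fin)
open import Data.Fin.Subset using (Subset; _∈_)
open import Data.List using (List; []; _∷_; _++_; map; filter; length)
open import Data.List using () renaming (allFin to allFinL)
open import Data.Product using (_×_)
open import Data.Sum using (_⊎_)
open import Relation.Binary.PropositionalEquality using (_≡_)
open import Relation.Nullary using (¬_)
open import Data.Bool using (T)
open import Relation.Nullary.Decidable using (Dec)
open import Data.Bool.Properties using (T?)

-- Vertices of G(U,F) where U = Fin n and F is a family of m subsets of U
-- indexed by Fin m.
data Vtx (n m : ℕ) : Set where
  a b : Vtx n m
  elem : Fin n → Vtx n m
  v u w : Fin m → Vtx n m

-- One orientation of each edge of G(U,F).
data Edge {n m : ℕ} (F : Fin m → Subset n) : Vtx n m → Vtx n m → Set where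
  a-elem : ∀ z → Edge F a (elem z)
  a-u    : ∀ t → Edge F a (u t)
  a-w    : ∀ t → Edge F a (w t)
  b-v    : ∀ t → Edge F b (v t)
  u-v    : ∀ t → Edge F (u t) (v t)
  w-v    : ∀ t → Edge F (w t) (v t)
  elem-v : ∀ z t → z ∈ F t → Edge F (elem z) (v t)

Adj : ∀ {n m} (F : Fin m → Subset n) → Vtx n m → Vtx n m → Set
Adj F x y = Edge F x y ⊎ Edge F y x

VSet : ℕ → ℕ → Set
VSet n m = Vtx n m → Bool

data Reach {n m : ℕ} (F : Fin m → Subset n) (S : VSet n m) : Vtx n m → Vtx n m → Set where
  here : ∀ {x} → S x ≡ false → Reach F S x x
  step : ∀ {x y z} → S x ≡ false → Adj F x y → Reach F S y z → Reach F S x z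

_⊆V_ : ∀ {n m} → VSet n m → VSet n m → Set
S ⊆V S' = ∀ x → S x ≡ true → S' x ≡ true

IsABSeparator : ∀ {n m} (F : Fin m → Subset n) → VSet n m → Set
IsABSeparator F S = S a ≡ false × S b ≡ false × ¬ Reach F S a b

IsMinimalABSeparator : ∀ {n m} (F : Fin m → Subset n) → VSet n m → Set
IsMinimalABSeparator F S =
  IsABSeparator F S × (∀ S' → S' ⊆V S → IsABSeparator F S' → S ⊆V S')

allVtx : (n m : ℕ) → List (Vtx n m)
allVtx n m = a ∷ b ∷ map elem (allFinL n) ++ map v (allFinL m)
             ++ map u (allFinL m) ++ map w (allFinL m)

card : ∀ {n m} → VSet n m → ℕ
card {n} {m} S = length (filter (λ x → T? (S x)) (allVtx n m))

-- Given a cover F' ⊆ F of U, take S = U ∪ {v_T : T ∉ F'} ∪ {u_T, w_T : T ∈ F'}, of size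
-- |U| + (|F| − |F'|) + 2|F'| = |U| + |F| + |F'|. In G − S the vertex a only reaches the
-- pendant-like vertices u_T, w_T with T ∉ F', whose unique other neighbour v_T is deleted,
-- so S separates a from b. It is minimal because every vertex of S is the middle of an
-- a,b-path of length three whose other inner vertex lies outside S: z ∈ T ∈ F' gives
-- a–z–v_T–b, and a–u_T–v_T–b, a–w_T–v_T–b serve the remaining vertices.
module Submission where

open import Defs
open import Data.Nat using (ℕ; suc; _+_; _≤_)
open import Data.Nat.Properties using (+-assoc; +-suc; +-monoʳ-≤; ≤-trans; ≤-reflexive)
open import Data.Bool using (Bool; true; false; not)
open import Data.Bool.Properties using (T?; not-¬; ¬-not; not-injective)
open import Data.Fin using (Fin)
import Data.Fin as Fin
open import Data.Fin.Subset using (Subset; _∈_; ∣_∣)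
open import Data.Vec using (_∷_; lookup)
import Data.Vec as Vec
open import Data.Vec.Properties using ([]=⇒lookup)
open import Data.List using (List; []; _∷_; _++_; map; filter; length; allFin; tabulate)
open import Data.List.Properties using (filter-++; length-++; map-tabulate; length-tabulate)
open import Data.Product using (Σ; ∃; _×_; _,_)
open import Data.Sum using (inj₁; inj₂)
open import Data.Unit using (⊤; tt)
open import Data.Empty using (⊥)
open import Function using (_∘_; id; const)
open import Function.Definitions using (Injective)
open import Relation.Binary.PropositionalEquality

countᵇ : {A : Set} → (A → Bool) → List A → ℕ
countᵇ p xs = length (filter (T? ∘ p) xs)

countᵇ-++ : {A : Set} (p : A → Bool) (xs ys : List A) →
            countᵇ p (xs ++ ys) ≡ countᵇ p xs + countᵇ p ys
countᵇ-++ p xs ys = trans (cong length (filter-++ (T? ∘ p) xs ys)) (length-++ (filter (T? ∘ p) xs))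

countᵇ-map : {A B : Set} (p : B → Bool) (f : A → B) (xs : List A) →
             countᵇ p (map f xs) ≡ countᵇ (p ∘ f) xs
countᵇ-map p f []       = refl
countᵇ-map p f (x ∷ xs) with p (f x)
... | true  = cong suc (countᵇ-map p f xs)
... | false = countᵇ-map p f xs

countᵇ-true : {A : Set} (xs : List A) → countᵇ (const true) xs ≡ length xs
countᵇ-true []       = refl
countᵇ-true (x ∷ xs) = cong suc (countᵇ-true xs)

countᵇ-not+countᵇ : {A : Set} (p : A → Bool) (xs : List A) →
                    countᵇ (not ∘ p) xs + countᵇ p xs ≡ length xs
countᵇ-not+countᵇ p []       = refl
countᵇ-not+countᵇ p (x ∷ xs) with p x
... | true  = trans (+-suc _ _) (cong suc (countᵇ-not+countᵇ p xs))
... | false = cong suc (countᵇ-not+countᵇ p xs)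

countᵇ-tabulate-suc : ∀ {k} (p : Fin (suc k) → Bool) →
                      countᵇ p (tabulate Fin.suc) ≡ countᵇ (p ∘ Fin.suc) (allFin k)
countᵇ-tabulate-suc {k} p =
  trans (cong (countᵇ p) (sym (map-tabulate id Fin.suc))) (countᵇ-map p Fin.suc (allFin k))

countᵇ-lookup-allFin : ∀ {k} (s : Subset k) → countᵇ (lookup s) (allFin k) ≡ ∣ s ∣
countᵇ-lookup-allFin Vec.[]       = refl
countᵇ-lookup-allFin (true ∷ s)  =
  cong suc (trans (countᵇ-tabulate-suc (lookup (true ∷ s))) (countᵇ-lookup-allFin s))
countᵇ-lookup-allFin (false ∷ s) =
  trans (countᵇ-tabulate-suc (lookup (false ∷ s))) (countᵇ-lookup-allFin s)

module _ {n m : ℕ} (F : Fin m → Subset n) where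

  Reach-head : ∀ {S x y} → Reach F S x y → S x ≡ false
  Reach-head (here Sx)     = Sx
  Reach-head (step Sx _ _) = Sx

  Reach-closed : ∀ {S} (P : Vtx n m → Set) →
                 (∀ {x y} → P x → S x ≡ false → Adj F x y → S y ≡ false → P y) →
                 ∀ {x y} → P x → Reach F S x y → P y
  Reach-closed P closed px (here _)          = px
  Reach-closed P closed px (step Sx xy reach) =
    Reach-closed P closed (closed px Sx xy (Reach-head reach)) reach

  separator-meets-path₃ : ∀ {S x y} → IsABSeparator F S →
                          Adj F a x → Adj F x y → Adj F y b → S x ≡ false → S y ≡ false → ⊥
  separator-meets-path₃ (Sa , Sb , ¬a⇝b) ax xy yb Sx Sy =
    ¬a⇝b (step Sa ax (step Sx xy (step Sy yb (here Sb))))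

⊆V-false : ∀ {n m} {S S' : VSet n m} → S' ⊆V S → ∀ x → S x ≡ false → S' x ≡ false
⊆V-false {S' = S'} S'⊆S x Sx with S' x in S'x
... | false = refl
... | true  = trans (sym (S'⊆S x S'x)) Sx

Covers : ∀ {n m} → (Fin m → Subset n) → Subset m → Set
Covers {n} F F' = ∀ (z : Fin n) → ∃ λ t → t ∈ F' × z ∈ F t

coverSeparator : ∀ {n m} → Subset m → VSet n m
coverSeparator F' a        = false
coverSeparator F' b        = false
coverSeparator F' (elem z) = true
coverSeparator F' (v t)    = not (lookup F' t)
coverSeparator F' (u t)    = lookup F' t
coverSeparator F' (w t)    = lookup F' t

module _ {n m : ℕ} (F : Fin m → Subset n) (F' : Subset m) where

  private
    S : VSet n m
    S = coverSeparator F'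

  aSide : Vtx n m → Set
  aSide a     = ⊤
  aSide (u t) = lookup F' t ≡ false
  aSide (w t) = lookup F' t ≡ false
  aSide _     = ⊥

  aSide-closed : ∀ {x y} → aSide x → S x ≡ false → Adj F x y → S y ≡ false → aSide y
  aSide-closed _  _ (inj₁ (a-elem z)) ()
  aSide-closed _  _ (inj₁ (a-u t))    Sy = Sy
  aSide-closed _  _ (inj₁ (a-w t))    Sy = Sy
  aSide-closed () _ (inj₁ (b-v t))    _
  aSide-closed px _ (inj₁ (u-v t))    Sy = not-¬ px (not-injective Sy)
  aSide-closed px _ (inj₁ (w-v t))    Sy = not-¬ px (not-injective Sy)
  aSide-closed () _ (inj₁ (elem-v z t _)) _
  aSide-closed () _ (inj₂ (a-elem z)) _
  aSide-closed _  _ (inj₂ (a-u t))    _  = tt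
  aSide-closed _  _ (inj₂ (a-w t))    _  = tt
  aSide-closed () _ (inj₂ (b-v t))    _
  aSide-closed () _ (inj₂ (u-v t))    _
  aSide-closed () _ (inj₂ (w-v t))    _
  aSide-closed () _ (inj₂ (elem-v z t _)) _

  coverSeparator-separates : IsABSeparator F S
  coverSeparator-separates = refl , refl , Reach-closed F aSide aSide-closed tt

  coverSeparator-minimal : Covers F F' →
                           ∀ S' → S' ⊆V S → IsABSeparator F S' → S ⊆V S'
  coverSeparator-minimal cover S' S'⊆S S'-sep = λ where
      (elem z) _ → let (t , t∈F' , z∈t) = cover z in
        ¬-not λ S'z → blocked (inj₁ (a-elem z)) (inj₁ (elem-v z t z∈t)) S'z
                              (outside (v t) (cong not ([]=⇒lookup t∈F')))
      (v t) Sv → ¬-not λ S'v → blocked (inj₁ (a-u t)) (inj₁ (u-v t))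
                                       (outside (u t) (not-injective Sv)) S'v
      (u t) Su → ¬-not λ S'u → blocked (inj₁ (a-u t)) (inj₁ (u-v t)) S'u
                                       (outside (v t) (cong not Su))
      (w t) Sw → ¬-not λ S'w → blocked (inj₁ (a-w t)) (inj₁ (w-v t)) S'w
                                       (outside (v t) (cong not Sw))
    where
    outside : ∀ x → S x ≡ false → S' x ≡ false
    outside = ⊆V-false S'⊆S
    blocked : ∀ {x t} → Adj F a x → Adj F x (v t) → S' x ≡ false → S' (v t) ≡ false → ⊥
    blocked {t = t} ax xv = separator-meets-path₃ F S'-sep ax xv (inj₂ (b-v t))

  card-coverSeparator : card S ≡ n + m + ∣ F' ∣
  -- a and b are outside S, so the filter in card drops them by computation.
  card-coverSeparator = begin
      countᵇ S (E ++ V ++ U ++ W)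
    ≡⟨ trans (countᵇ-++ S E _) (cong (countᵇ S E +_) (trans (countᵇ-++ S V _)
                                    (cong (countᵇ S V +_) (countᵇ-++ S U W)))) ⟩
      countᵇ S E + (countᵇ S V + (countᵇ S U + countᵇ S W))
    ≡⟨ cong₂ _+_ (countᵇ-map S elem (allFin n)) (cong₂ _+_ (countᵇ-map S v (allFin m))
                   (cong₂ _+_ (countᵇ-map S u (allFin m)) (countᵇ-map S w (allFin m)))) ⟩
      #U + (#∉F' + (#F' + #F'))
    ≡⟨ cong (#U +_) (sym (+-assoc #∉F' #F' #F')) ⟩
      #U + (#∉F' + #F' + #F')
    ≡⟨ sym (+-assoc #U (#∉F' + #F') #F') ⟩
      #U + (#∉F' + #F') + #F'
    ≡⟨ cong₂ _+_ (cong₂ _+_ (trans (countᵇ-true (allFin n)) (length-tabulate {n = n} id))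
                            (trans (countᵇ-not+countᵇ (lookup F') (allFin m)) (length-tabulate {n = m} id)))
                 (countᵇ-lookup-allFin F') ⟩
      n + m + ∣ F' ∣ ∎
    where
    open ≡-Reasoning
    E V U W : List (Vtx n m)
    E = map elem (allFin n)
    V = map v (allFin m)
    U = map u (allFin m)
    W = map w (allFin m)
    #U #∉F' #F' : ℕ
    #U   = countᵇ (const true) (allFin n)
    #∉F' = countᵇ (not ∘ lookup F') (allFin m)
    #F'  = countᵇ (lookup F') (allFin m)

lemma2 : (n m k : ℕ) (F : Fin m → Subset n) → Injective _≡_ _≡_ F →
    (Σ (Subset m) λ F' → ∣ F' ∣ ≤ k × (∀ z → ∃ λ t → t ∈ F' × z ∈ F t)) →
    Σ (VSet n m) λ S → IsMinimalABSeparator F S × S a ≡ false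
      × (∀ z → S (elem z) ≡ true) × card S ≤ n + m + k
lemma2 n m k F _ (F' , ∣F'∣≤k , cover) =
    coverSeparator F'
  , (coverSeparator-separates F F' , coverSeparator-minimal F F' cover)
  , refl
  , (λ _ → refl)
  , ≤-trans (≤-reflexive (card-coverSeparator F F')) (+-monoʳ-≤ (n + m) ∣F'∣≤k)
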